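{- Let $\varphi\in\mathrm{PL}(\{\wedge,\vee,\mathbin{\dot\vee}\})$ and let $\Phi$ be a domain containing the variables of $\varphi$. If a $\Phi$-team $T$ satisfies $\varphi^{\mathrm{lax}}$, then there is a domain $\Psi\supseteq\Phi$ such that $T[\Psi]\models\varphi$.
   Context: A domain is a finite subset of an infinite supply of propositional variables; a $\Phi$-team is a set of maps $\Phi\to\{0,1\}$. A split of $T$ is $(T_1,T_2)$ with $T_1,T_2\subseteq T$, $T_1\cup T_2=T$; strict if $T_1\cap T_2=\emptyset$. $\mathrm{PL}(\{\wedge,\vee,\mathbin{\dot\vee}\})$-formulas are built from the literals $\top,\bot,{\sim}\top,{\sim}\bot,p,\neg p,{\sim}p,{\sim}\neg p$ using $\wedge,\vee,\mathbin{\dot\vee}$, with $T\models\top$ always; $T\models\bot$ iff $T=\emptyset$; $T\models p$ iff $s(p)=1$ for all $s\in T$; $T\models\neg p$ iff $s(p)=0$ for all $s\in T$; $T\models{\sim}\ell$ iff $T\not\models\ell$; $\wedge$ conjunction; $T\models\psi\vee\theta$ iff some split $(S,U)$ has $S\models\psi,U\models\theta$; $\mathbin{\dot\vee}$ likewise with strict splits. The relaxation $\varphi^{\mathrm{lax}}$ is obtained from $\varphi$ by replacing every $\mathbin{\dot\vee}$ by $\vee$. For a $\Phi$-team $T$ and $\Psi\supseteq\Phi$, $T[\Psi]=\{s:\Psi\to\{0,1\}\mid s\restriction\Phi\in T\}$. -}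

module Defs where

open import Data.Nat using (ℕ)
open import Data.Nat.Properties using (_≟_)
open import Data.Bool using (Bool; true; false)
open import Data.List using (List; []; _∷_; _++_; length)
open import Data.List.Relation.Unary.Any using (index)
open import Data.List.Relation.Unary.Unique.Propositional using (Unique)
open import Data.List.Membership.Propositional using (_∈_)
open import Data.List.Membership.DecPropositional _≟_ using (_∈?_)
import Data.List as L
open import Data.Vec using (Vec; lookup; tabulate)
open import Data.Product using (_×_; Σ)
open import Data.Unit using (⊤)
open import Relation.Binary.PropositionalEquality using (_≡_)
open import Data.Sum using (_⊎_)
open import Data.Empty using (⊥)
open import Relation.Nullary using (¬_; yes; no)
open import Level using (Level; suc; zero; Lift)

Var : Set
Var = ℕ

record Domain : Set where
  constructor dom
  field
    vars   : List Var
    unique : Unique vars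
open Domain public

_⊆D_ : Domain → Domain → Set
Φ ⊆D Ψ = ∀ {x} → x ∈ vars Φ → x ∈ vars Ψ

-- A map Φ → {0,1}: one Boolean per (distinct) variable of Φ, in list order.
Assignment : Domain → Set
Assignment Φ = Vec Bool (length (vars Φ))

-- value s(p) of variable p under s (default false if p ∉ Φ; never used
-- under the hypothesis that the formula's variables lie in Φ)
val : (Φ : Domain) → Assignment Φ → Var → Bool
val Φ s p with p ∈? vars Φ
... | yes p∈ = lookup s (index p∈)
... | no _   = false

-- A Φ-team: a set of Φ-assignments (as a predicate).
-- (wrapped in a record so that Φ is inferable from a team)
-- Membership is Boolean (decidable): a team is a subset of the finite set
-- of Φ-assignments, i.e. its characteristic function.
record Team (Φ : Domain) : Set where
  constructor team
  field
    mem : Assignment Φ → Bool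
open Team public

_∋_ : {Φ : Domain} → Team Φ → Assignment Φ → Set
T ∋ s = mem T s ≡ true

_⊆T_ : {Φ : Domain} → Team Φ → Team Φ → Set
_⊆T_ {Φ} T U = ∀ (s : Assignment Φ) → T ∋ s → U ∋ s

IsEmpty : {Φ : Domain} → Team Φ → Set
IsEmpty {Φ} T = ∀ (s : Assignment Φ) → ¬ (T ∋ s)

IsSplit : {Φ : Domain} → Team Φ → Team Φ → Team Φ → Set
IsSplit {Φ} T T₁ T₂ = (T₁ ⊆T T) × (T₂ ⊆T T) × (∀ (s : Assignment Φ) → T ∋ s → (T₁ ∋ s) ⊎ (T₂ ∋ s))

IsStrictSplit : {Φ : Domain} → Team Φ → Team Φ → Team Φ → Set
IsStrictSplit {Φ} T T₁ T₂ = IsSplit T T₁ T₂ × (∀ (s : Assignment Φ) → T₁ ∋ s → T₂ ∋ s → ⊥)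

data Atom : Set where
  ⊤a ⊥a : Atom
  pos neg : Var → Atom

data Lit : Set where
  +_ : Atom → Lit
  ∼_ : Atom → Lit

data Form : Set where
  lit   : Lit → Form
  _∧'_  : Form → Form → Form
  _∨'_  : Form → Form → Form
  _∨̇_   : Form → Form → Form

atomVars : Atom → List Var
atomVars ⊤a = []
atomVars ⊥a = []
atomVars (pos p) = p ∷ []
atomVars (neg p) = p ∷ []

litVars : Lit → List Var
litVars (+ a) = atomVars a
litVars (∼ a) = atomVars a

fvars : Form → List Var
fvars (lit l) = litVars l
fvars (φ ∧' ψ) = fvars φ ++ fvars ψ
fvars (φ ∨' ψ) = fvars φ ++ fvars ψ
fvars (φ ∨̇ ψ) = fvars φ ++ fvars ψ

lax : Form → Form
lax (lit l) = lit l
lax (φ ∧' ψ) = lax φ ∧' lax ψ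
lax (φ ∨' ψ) = lax φ ∨' lax ψ
lax (φ ∨̇ ψ) = lax φ ∨' lax ψ

_⊨ᵃ_ : {Φ : Domain} → Team Φ → Atom → Set
_⊨ᵃ_ {Φ} T ⊤a = ⊤
_⊨ᵃ_ {Φ} T ⊥a = IsEmpty T
_⊨ᵃ_ {Φ} T (pos p) = ∀ (s : Assignment Φ) → T ∋ s → val Φ s p ≡ true
_⊨ᵃ_ {Φ} T (neg p) = ∀ (s : Assignment Φ) → T ∋ s → val Φ s p ≡ false

_⊨ˡ_ : {Φ : Domain} → Team Φ → Lit → Set
T ⊨ˡ (+ a) = T ⊨ᵃ a
T ⊨ˡ (∼ a) = ¬ (T ⊨ᵃ a)

_⊨_ : {Φ : Domain} → Team Φ → Form → Set
T ⊨ lit l = T ⊨ˡ l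
T ⊨ (φ ∧' ψ) = (T ⊨ φ) × (T ⊨ ψ)
_⊨_ {Φ} T (φ ∨' ψ) = Σ (Team Φ) λ S → Σ (Team Φ) λ U →
  IsSplit T S U × (S ⊨ φ) × (U ⊨ ψ)
_⊨_ {Φ} T (φ ∨̇ ψ) = Σ (Team Φ) λ S → Σ (Team Φ) λ U →
  IsStrictSplit T S U × (S ⊨ φ) × (U ⊨ ψ)

-- restriction of a Ψ-assignment to Φ (meaningful when Φ ⊆ Ψ)
restrict : (Φ Ψ : Domain) → Assignment Ψ → Assignment Φ
restrict Φ Ψ s = tabulate (λ i → val Ψ s (L.lookup (vars Φ) i))

extendTeam : {Φ : Domain} → Team Φ → (Ψ : Domain) → Team Ψ
extendTeam {Φ} T Ψ = team (λ s → mem T (restrict Φ Ψ s))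

-- Team semantics of these formulas is local: satisfaction depends only on the
-- restriction of a team to the variables of the formula, so formulas without
-- ∨̇ transfer between T and every cylinder T[Ψ]. A split (A , B) of T witnessing
-- a relaxed ∨̇ is made strict on T[Φ ∪ {h}] for a fresh variable h, by letting
-- the value of h decide on which side a point of A ∩ B lies; both sides still
-- restrict onto A and B, so by locality they satisfy the relaxed disjuncts.
-- Induction on φ then yields a domain Ψ₀ such that φ holds on T[Ψ] for every
-- Ψ ⊇ Ψ₀; conjunctions and disjunctions combine two such domains by union.
module Submission where

open import Defs
open import Data.Nat.Properties using (_≟_; ≡-irrelevant; m≤m+n; m≤n+m; ≤-trans; 1+n≰n)
open import Data.Bool using (Bool; true; false; _∧_; _∨_; not)
open import Data.Empty using (⊥; ⊥-elim)
open import Data.Fin using (Fin; zero; suc)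
open import Data.List using (List; []; _∷_; _++_; deduplicate)
import Data.List as List
open import Data.List.Membership.Propositional using (_∈_; _∉_)
open import Data.List.Membership.Propositional.Properties
  using (∈-lookup; ∈-++⁺ˡ; ∈-++⁺ʳ; ∈-deduplicate⁺)
open import Data.List.Membership.DecPropositional _≟_ using (_∈?_)
open import Data.List.Membership.Setoid.Properties using (unique⇒irrelevant)
open import Data.List.Relation.Unary.All using (All; []; _∷_)
import Data.List.Relation.Unary.All as All
open import Data.List.Relation.Unary.All.Properties using (++⁻ˡ; ++⁻ʳ)
open import Data.List.Relation.Unary.AllPairs using (_∷_)
open import Data.List.Relation.Unary.Any using (here; there; index)
open import Data.List.Relation.Unary.Any.Properties using (lookup-index)
open import Data.List.Relation.Unary.Unique.Propositional using (Unique)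
open import Data.List.Relation.Unary.Unique.DecPropositional.Properties _≟_
  using (deduplicate-!)
open import Data.Nat using (ℕ; suc; _≤_)
open import Data.Nat.ListAction using (sum)
open import Data.Product using (Σ; _×_; _,_; proj₁; proj₂)
open import Data.Sum using (_⊎_; inj₁; inj₂)
open import Data.Vec using (lookup; head) renaming (_∷_ to _∷ᵛ_)
open import Data.Vec.Properties using (lookup∘tabulate; tabulate∘lookup; tabulate-cong)
open import Function using (id; _∘_)
open import Relation.Nullary using (yes; no)
open import Relation.Binary.PropositionalEquality
  using (_≡_; refl; sym; trans; cong; cong₂; setoid; module ≡-Reasoning)

private
  variable
    Φ Ψ Ψ₁ : Domain

∧-elimˡ : ∀ {x y} → x ∧ y ≡ true → x ≡ true
∧-elimˡ {true} _ = refl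

∧-elimʳ : ∀ {x y} → x ∧ y ≡ true → y ≡ true
∧-elimʳ {true} h = h

∧-intro : ∀ {x y} → x ≡ true → y ≡ true → x ∧ y ≡ true
∧-intro refl refl = refl


index-irrelevant : ∀ {xs : List Var} {x} → Unique xs → (p q : x ∈ xs) → index p ≡ index q
index-irrelevant u p q = cong index (unique⇒irrelevant (setoid Var) ≡-irrelevant u p q)

index-∈-lookup : (xs : List Var) (i : Fin (List.length xs)) → index (∈-lookup {xs = xs} i) ≡ i
index-∈-lookup (_ ∷ _)  zero    = refl
index-∈-lookup (_ ∷ xs) (suc i) = cong suc (index-∈-lookup xs i)

val-∈ : (Φ : Domain) (s : Assignment Φ) {x : Var} (q : x ∈ vars Φ) → val Φ s x ≡ lookup s (index q)
val-∈ Φ s {x} q with x ∈? vars Φ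
... | yes p = cong (lookup s) (index-irrelevant (unique Φ) p q)
... | no x∉ = ⊥-elim (x∉ q)

restrict-id : (Φ : Domain) (s : Assignment Φ) → restrict Φ Φ s ≡ s
restrict-id Φ s = trans (tabulate-cong val-lookup) (tabulate∘lookup s)
  where
  val-lookup : ∀ i → val Φ s (List.lookup (vars Φ) i) ≡ lookup s i
  val-lookup i = trans (val-∈ Φ s (∈-lookup i)) (cong (lookup s) (index-∈-lookup (vars Φ) i))

restrict-cong : {Φ Ψ Ψ′ : Domain} {s : Assignment Ψ} {s′ : Assignment Ψ′} →
  (∀ {x} → x ∈ vars Φ → val Ψ s x ≡ val Ψ′ s′ x) →
  restrict Φ Ψ s ≡ restrict Φ Ψ′ s′
restrict-cong agree = tabulate-cong (λ i → agree (∈-lookup i))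

-- No inclusion Φ ⊆ Ψ is needed: outside Ψ both sides read the default value.
val-restrict : (Φ Ψ : Domain) (s : Assignment Ψ) {x : Var} → x ∈ vars Φ →
  val Φ (restrict Φ Ψ s) x ≡ val Ψ s x
val-restrict Φ Ψ s {x} q = begin
  val Φ (restrict Φ Ψ s) x                          ≡⟨ val-∈ Φ (restrict Φ Ψ s) q ⟩
  lookup (restrict Φ Ψ s) (index q)                 ≡⟨ lookup∘tabulate _ (index q) ⟩
  val Ψ s (List.lookup (vars Φ) (index q))          ≡⟨ cong (val Ψ s) (sym (lookup-index q)) ⟩
  val Ψ s x                                         ∎
  where open ≡-Reasoning

restrict-∘ : (Φ Ψ₁ Ψ : Domain) → Φ ⊆D Ψ₁ → (s : Assignment Ψ) →
  restrict Φ Ψ₁ (restrict Ψ₁ Ψ s) ≡ restrict Φ Ψ s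
restrict-∘ Φ Ψ₁ Ψ Φ⊆Ψ₁ s = restrict-cong {Φ} {Ψ₁} {Ψ} (val-restrict Ψ₁ Ψ s ∘ Φ⊆Ψ₁)

restrict-surjective : (Φ Ψ : Domain) → Φ ⊆D Ψ → (t : Assignment Φ) →
  Σ (Assignment Ψ) λ s → restrict Φ Ψ s ≡ t
restrict-surjective Φ Ψ Φ⊆Ψ t = restrict Ψ Φ t , trans (restrict-∘ Φ Ψ Φ Φ⊆Ψ t) (restrict-id Φ t)


record _↠_ (X : Team Ψ) (Y : Team Φ) : Set where
  field
    into : ∀ s → X ∋ s → Y ∋ restrict Φ Ψ s
    onto : ∀ t → Y ∋ t → Σ (Assignment Ψ) λ s → X ∋ s × restrict Φ Ψ s ≡ t
open _↠_

InScope : Domain → Form → Set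
InScope Φ φ = All (_∈ vars Φ) (fvars φ)

module _ {X : Team Ψ} {Y : Team Φ} (X↠Y : X ↠ Y) where

  const-lift : ∀ {x} b → x ∈ vars Φ →
    (∀ t → Y ∋ t → val Φ t x ≡ b) → ∀ s → X ∋ s → val Ψ s x ≡ b
  const-lift b q h s s∈X = trans (sym (val-restrict Φ Ψ s q)) (h _ (into X↠Y s s∈X))

  const-lower : ∀ {x} b → x ∈ vars Φ →
    (∀ s → X ∋ s → val Ψ s x ≡ b) → ∀ t → Y ∋ t → val Φ t x ≡ b
  const-lower b q h t t∈Y with onto X↠Y t t∈Y
  ... | s , s∈X , refl = trans (val-restrict Φ Ψ s q) (h s s∈X)

  ⊨ᵃ-lift : (a : Atom) → All (_∈ vars Φ) (atomVars a) → Y ⊨ᵃ a → X ⊨ᵃ a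
  ⊨ᵃ-lift ⊤a      _        h = h
  ⊨ᵃ-lift ⊥a      _        h s s∈X = h _ (into X↠Y s s∈X)
  ⊨ᵃ-lift (pos p) (q ∷ []) h = const-lift true q h
  ⊨ᵃ-lift (neg p) (q ∷ []) h = const-lift false q h

  ⊨ᵃ-lower : (a : Atom) → All (_∈ vars Φ) (atomVars a) → X ⊨ᵃ a → Y ⊨ᵃ a
  ⊨ᵃ-lower ⊤a      _        h = h
  ⊨ᵃ-lower ⊥a      _        h t t∈Y = h _ (proj₁ (proj₂ (onto X↠Y t t∈Y)))
  ⊨ᵃ-lower (pos p) (q ∷ []) h = const-lower true q h
  ⊨ᵃ-lower (neg p) (q ∷ []) h = const-lower false q h

preimage : Team Ψ → Team Φ → Team Ψ
preimage {Ψ} {Φ} X A = team (λ s → mem X s ∧ mem A (restrict Φ Ψ s))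

module _ {X : Team Ψ} {Y : Team Φ} (X↠Y : X ↠ Y) where

  preimage-↠ : {A : Team Φ} → A ⊆T Y → preimage X A ↠ A
  into (preimage-↠ _) s = ∧-elimʳ
  onto (preimage-↠ A⊆Y) t t∈A with onto X↠Y t (A⊆Y t t∈A)
  ... | s , s∈X , refl = s , ∧-intro s∈X t∈A , refl

  preimage-split : {A B : Team Φ} → IsSplit Y A B → IsSplit X (preimage X A) (preimage X B)
  preimage-split {A} {B} (_ , _ , cover) = (λ _ → ∧-elimˡ) , (λ _ → ∧-elimˡ) , cover′
    where
    cover′ : ∀ s → X ∋ s → preimage X A ∋ s ⊎ preimage X B ∋ s
    cover′ s s∈X with cover _ (into X↠Y s s∈X)
    ... | inj₁ a = inj₁ (∧-intro s∈X a)
    ... | inj₂ b = inj₂ (∧-intro s∈X b)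

  preimage-strictSplit : {A B : Team Φ} → IsStrictSplit Y A B →
    IsStrictSplit X (preimage X A) (preimage X B)
  preimage-strictSplit (split , disjoint) =
    preimage-split split , λ s a b → disjoint _ (∧-elimʳ a) (∧-elimʳ b)

⊨-lift : (φ : Form) → InScope Φ φ → {X : Team Ψ} {Y : Team Φ} → X ↠ Y → Y ⊨ φ → X ⊨ φ
⊨-lift (lit (+ a)) sc X↠Y h = ⊨ᵃ-lift X↠Y a sc h
⊨-lift (lit (∼ a)) sc X↠Y h = h ∘ ⊨ᵃ-lower X↠Y a sc
⊨-lift (φ ∧' ψ) sc X↠Y (hφ , hψ) =
  ⊨-lift φ (++⁻ˡ (fvars φ) sc) X↠Y hφ , ⊨-lift ψ (++⁻ʳ (fvars φ) sc) X↠Y hψ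
⊨-lift (φ ∨' ψ) sc {X} X↠Y (A , B , split@(A⊆ , B⊆ , _) , hA , hB) =
  preimage X A , preimage X B , preimage-split X↠Y split ,
  ⊨-lift φ (++⁻ˡ (fvars φ) sc) (preimage-↠ X↠Y A⊆) hA ,
  ⊨-lift ψ (++⁻ʳ (fvars φ) sc) (preimage-↠ X↠Y B⊆) hB
⊨-lift (φ ∨̇ ψ) sc {X} X↠Y (A , B , split@((A⊆ , B⊆ , _) , _) , hA , hB) =
  preimage X A , preimage X B , preimage-strictSplit X↠Y split ,
  ⊨-lift φ (++⁻ˡ (fvars φ) sc) (preimage-↠ X↠Y A⊆) hA ,
  ⊨-lift ψ (++⁻ʳ (fvars φ) sc) (preimage-↠ X↠Y B⊆) hB

fvars-lax : (φ : Form) → fvars (lax φ) ≡ fvars φ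
fvars-lax (lit l)  = refl
fvars-lax (φ ∧' ψ) = cong₂ _++_ (fvars-lax φ) (fvars-lax ψ)
fvars-lax (φ ∨' ψ) = cong₂ _++_ (fvars-lax φ) (fvars-lax ψ)
fvars-lax (φ ∨̇ ψ) = cong₂ _++_ (fvars-lax φ) (fvars-lax ψ)

inScope-lax : (Φ : Domain) (φ : Form) → InScope Φ φ → InScope Φ (lax φ)
inScope-lax Φ φ rewrite fvars-lax φ = id


extendTeam-↠ : (T : Team Φ) (Ψ : Domain) → Φ ⊆D Ψ → extendTeam T Ψ ↠ T
into (extendTeam-↠ T Ψ _) _ = id
onto (extendTeam-↠ {Φ} T Ψ Φ⊆Ψ) t t∈T with restrict-surjective Φ Ψ Φ⊆Ψ t
... | s , refl = s , t∈T , refl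

extendTeam-∘ : (T : Team Φ) (Ψ₁ Ψ : Domain) → Φ ⊆D Ψ₁ → (s : Assignment Ψ) →
  mem (extendTeam (extendTeam T Ψ₁) Ψ) s ≡ mem (extendTeam T Ψ) s
extendTeam-∘ {Φ} T Ψ₁ Ψ Φ⊆Ψ₁ s = cong (mem T) (restrict-∘ Φ Ψ₁ Ψ Φ⊆Ψ₁ s)

module _ (X : Team Ψ) (W : Team Φ) (X≡W[Ψ] : ∀ s → mem X s ≡ mem W (restrict Φ Ψ s)) {A B : Team Φ} where

  IsSplit-extend : IsSplit W A B → IsSplit X (extendTeam A Ψ) (extendTeam B Ψ)
  IsSplit-extend (A⊆W , B⊆W , cover) =
    (λ s → trans (X≡W[Ψ] s) ∘ A⊆W _) ,
    (λ s → trans (X≡W[Ψ] s) ∘ B⊆W _) ,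
    (λ s → cover _ ∘ trans (sym (X≡W[Ψ] s)))

  IsStrictSplit-extend : IsStrictSplit W A B → IsStrictSplit X (extendTeam A Ψ) (extendTeam B Ψ)
  IsStrictSplit-extend (split , disjoint) = IsSplit-extend split , λ s → disjoint _


∈⇒≤sum : ∀ {n} {ns : List ℕ} → n ∈ ns → n ≤ sum ns
∈⇒≤sum {ns = m ∷ ms} (here refl) = m≤m+n m (sum ms)
∈⇒≤sum {ns = m ∷ ms} (there q)   = ≤-trans (∈⇒≤sum q) (m≤n+m (sum ms) m)

freshVar : Domain → Var
freshVar Φ = suc (sum (vars Φ))

freshVar-∉ : (Φ : Domain) → freshVar Φ ∉ vars Φ
freshVar-∉ Φ = 1+n≰n ∘ ∈⇒≤sum

withFresh : Domain → Domain
withFresh Φ = dom (freshVar Φ ∷ vars Φ)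
  (All.tabulate (λ {y} y∈ h → freshVar-∉ Φ (subst∈ h y∈)) ∷ unique Φ)
  where
  subst∈ : ∀ {x y} → x ≡ y → y ∈ vars Φ → x ∈ vars Φ
  subst∈ refl = id

⊆-withFresh : (Φ : Domain) → Φ ⊆D withFresh Φ
⊆-withFresh _ = there

restrict-∷ : (Φ : Domain) (b : Bool) (t : Assignment Φ) → restrict Φ (withFresh Φ) (b ∷ᵛ t) ≡ t
restrict-∷ Φ b t =
  trans (restrict-cong {Φ} {withFresh Φ} {Φ} agree) (restrict-id Φ t)
  where
  agree : ∀ {x} → x ∈ vars Φ → val (withFresh Φ) (b ∷ᵛ t) x ≡ val Φ t x
  agree q = trans (val-∈ (withFresh Φ) (b ∷ᵛ t) (there q)) (sym (val-∈ Φ t q))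

-- The fresh bit h decides the side of points of A ∩ B: h = false puts them in A⁺,
-- h = true in B⁺. The bit is tested first so that the fibres reduce definitionally.
module Separate {A B : Team Φ} where

  private
    r : Assignment (withFresh Φ) → Assignment Φ
    r = restrict Φ (withFresh Φ)

  A⁺ B⁺ : Team (withFresh Φ)
  A⁺ = team (λ s → (not (head s) ∨ not (mem B (r s))) ∧ mem A (r s))
  B⁺ = team (λ s → (head s ∨ not (mem A (r s))) ∧ mem B (r s))

  A⁺↠A : A⁺ ↠ A
  into A⁺↠A _ = ∧-elimʳ
  onto A⁺↠A t t∈A = false ∷ᵛ t , trans (cong (mem A) (restrict-∷ Φ false t)) t∈A , restrict-∷ Φ false t

  B⁺↠B : B⁺ ↠ B
  into B⁺↠B _ = ∧-elimʳ
  onto B⁺↠B t t∈B = true ∷ᵛ t , trans (cong (mem B) (restrict-∷ Φ true t)) t∈B , restrict-∷ Φ true t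

  private
    cover-bits : ∀ h a b → a ≡ true ⊎ b ≡ true →
      (not h ∨ not b) ∧ a ≡ true ⊎ (h ∨ not a) ∧ b ≡ true
    cover-bits false true  _     _ = inj₁ refl
    cover-bits false false true  _ = inj₂ refl
    cover-bits true  _     true  _ = inj₂ refl
    cover-bits true  true  false _ = inj₁ refl
    cover-bits _     false false (inj₁ ())
    cover-bits _     false false (inj₂ ())

    disjoint-bits : ∀ h a b → (not h ∨ not b) ∧ a ≡ true → (h ∨ not a) ∧ b ≡ true → ⊥
    disjoint-bits false true  true  _  ()
    disjoint-bits false true  false _  ()
    disjoint-bits true  true  true  () _
    disjoint-bits true  true  false _  ()
    disjoint-bits false false _     () _
    disjoint-bits true  false true  () _
    disjoint-bits true  false false () _

  strictSplit : {T : Team Φ} → IsSplit T A B → IsStrictSplit (extendTeam T (withFresh Φ)) A⁺ B⁺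
  strictSplit (A⊆T , B⊆T , cover) =
    ((λ s → A⊆T (r s) ∘ ∧-elimʳ) , (λ s → B⊆T (r s) ∘ ∧-elimʳ) ,
     (λ s → cover-bits (head s) (mem A (r s)) (mem B (r s)) ∘ cover (r s))) ,
    λ s → disjoint-bits (head s) (mem A (r s)) (mem B (r s))

  strictSplit-extend : {T : Team Φ} → IsSplit T A B → (Ψ : Domain) →
    IsStrictSplit (extendTeam T Ψ) (extendTeam A⁺ Ψ) (extendTeam B⁺ Ψ)
  strictSplit-extend {T} split Ψ =
    IsStrictSplit-extend (extendTeam T Ψ) (extendTeam T (withFresh Φ))
      (sym ∘ extendTeam-∘ T (withFresh Φ) Ψ (⊆-withFresh Φ)) (strictSplit split)


record Eventually (Φ : Domain) (P : Domain → Set) : Set where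
  constructor eventually
  field
    base   : Domain
    ⊆-base : Φ ⊆D base
    holds  : ∀ Ψ → base ⊆D Ψ → P Ψ

always : {P : Domain → Set} → (∀ Ψ → Φ ⊆D Ψ → P Ψ) → Eventually Φ P
always {Φ} = eventually Φ id

eventually-map : {P Q : Domain → Set} → (∀ Ψ → P Ψ → Q Ψ) → Eventually Φ P → Eventually Φ Q
eventually-map f (eventually Ψ₀ Φ⊆Ψ₀ h) = eventually Ψ₀ Φ⊆Ψ₀ λ Ψ Ψ₀⊆Ψ → f Ψ (h Ψ Ψ₀⊆Ψ)

eventually-weaken : {P : Domain → Set} → Φ ⊆D Ψ₁ → Eventually Ψ₁ P → Eventually Φ P
eventually-weaken Φ⊆Ψ₁ (eventually Ψ₀ Ψ₁⊆Ψ₀ h) = eventually Ψ₀ (Ψ₁⊆Ψ₀ ∘ Φ⊆Ψ₁) h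

_∪D_ : Domain → Domain → Domain
Ψ₁ ∪D Ψ₂ = dom (deduplicate _≟_ (vars Ψ₁ ++ vars Ψ₂)) (deduplicate-! (vars Ψ₁ ++ vars Ψ₂))

eventually-× : {P Q : Domain → Set} → Eventually Φ P → Eventually Φ Q →
  Eventually Φ (λ Ψ → P Ψ × Q Ψ)
eventually-× (eventually Ψ₁ Φ⊆Ψ₁ hP) (eventually Ψ₂ _ hQ) =
  eventually (Ψ₁ ∪D Ψ₂) (⊆ˡ ∘ Φ⊆Ψ₁) λ Ψ ∪⊆Ψ → hP Ψ (∪⊆Ψ ∘ ⊆ˡ) , hQ Ψ (∪⊆Ψ ∘ ⊆ʳ)
  where
  ⊆ˡ : Ψ₁ ⊆D (Ψ₁ ∪D Ψ₂)
  ⊆ˡ = ∈-deduplicate⁺ _≟_ ∘ ∈-++⁺ˡ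
  ⊆ʳ : Ψ₂ ⊆D (Ψ₁ ∪D Ψ₂)
  ⊆ʳ = ∈-deduplicate⁺ _≟_ ∘ ∈-++⁺ʳ (vars Ψ₁)


lax⇒eventually : (φ : Form) → InScope Φ φ → (T : Team Φ) → T ⊨ lax φ →
  Eventually Φ (λ Ψ → extendTeam T Ψ ⊨ φ)
lax⇒eventually φ@(lit _) sc T h = always (λ Ψ Φ⊆Ψ → ⊨-lift φ sc (extendTeam-↠ T Ψ Φ⊆Ψ) h)
lax⇒eventually (φ ∧' ψ) sc T (hφ , hψ) =
  eventually-× (lax⇒eventually φ (++⁻ˡ (fvars φ) sc) T hφ)
               (lax⇒eventually ψ (++⁻ʳ (fvars φ) sc) T hψ)
lax⇒eventually (φ ∨' ψ) sc T (A , B , split , hA , hB) =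
  eventually-map (λ Ψ (hφ , hψ) → extendTeam A Ψ , extendTeam B Ψ ,
                                   IsSplit-extend (extendTeam T Ψ) T (λ _ → refl) split , hφ , hψ)
    (eventually-× (lax⇒eventually φ (++⁻ˡ (fvars φ) sc) A hA)
                  (lax⇒eventually ψ (++⁻ʳ (fvars φ) sc) B hB))
lax⇒eventually {Φ} (φ ∨̇ ψ) sc T (A , B , split , hA , hB) =
  eventually-weaken (⊆-withFresh Φ)
    (eventually-map (λ Ψ (hφ , hψ) → extendTeam A⁺ Ψ , extendTeam B⁺ Ψ ,
                                      strictSplit-extend split Ψ , hφ , hψ)
      (eventually-× (lax⇒eventually φ (All.map there scφ) A⁺ (lift φ scφ A⁺↠A hA))
                    (lax⇒eventually ψ (All.map there scψ) B⁺ (lift ψ scψ B⁺↠B hB))))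
  where
  open Separate {Φ} {A} {B}
  scφ = ++⁻ˡ (fvars φ) sc
  scψ = ++⁻ʳ (fvars φ) sc
  lift : (χ : Form) → InScope Φ χ → {X : Team (withFresh Φ)} {Y : Team Φ} →
    X ↠ Y → Y ⊨ lax χ → X ⊨ lax χ
  lift χ scχ = ⊨-lift (lax χ) (inScope-lax Φ χ scχ)

lemma3p15 : (φ : Form) (Φ : Domain) → All (λ x → x ∈ vars Φ) (fvars φ) →
    (T : Team Φ) → T ⊨ lax φ →
    Σ Domain (λ Ψ → (Φ ⊆D Ψ) × (extendTeam T Ψ ⊨ φ))
lemma3p15 φ Φ sc T h = base , ⊆-base , holds base id
  where open Eventually (lax⇒eventually φ sc T h)
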